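{- Let $G$ be an Eulerian multigraph (finite, without loops) which is interval colorable. Then $|E(G)|$ is even.
   Context: A multigraph may have multiple edges but no loops; all multigraphs are finite. A multigraph $G$ is Eulerian if it has a closed trail containing every edge of $G$. A proper edge-coloring of $G$ assigns colors to edges so that no two adjacent edges receive the same color. For a proper edge-coloring $\alpha$ and $v\in V(G)$, $S(v,\alpha)$ denotes the set of colors of edges incident to $v$. A proper edge-coloring of $G$ with colors $1,\ldots,t$ is an interval $t$-coloring if all colors $1,\ldots,t$ are used and for every vertex $v$ the set $S(v,\alpha)$ is an interval of consecutive integers. $G$ is interval colorable if it has an interval $t$-coloring for some positive integer $t$. -}

module Defs where

open import Data.Nat using (ℕ; suc; _≤_; _<_)
open import Data.Fin using (Fin; zero; suc; fromℕ; inject₁)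
open import Data.Product using (Σ; _×_; _,_; proj₁; proj₂; ∃)
open import Data.Sum using (_⊎_)
open import Relation.Binary.PropositionalEquality using (_≡_; _≢_)
open import Relation.Nullary using (¬_)
open import Function.Bundles using (_⤖_; Bijection)

record Multigraph : Set where
  field
    n      : ℕ
    m      : ℕ
    ends   : Fin m → Fin n × Fin n
    noLoop : ∀ e → proj₁ (ends e) ≢ proj₂ (ends e)

module _ (G : Multigraph) where
  open Multigraph G

  Incident : Fin m → Fin n → Set
  Incident e v = proj₁ (ends e) ≡ v ⊎ proj₂ (ends e) ≡ v

  Joins : Fin m → Fin n → Fin n → Set
  Joins e a b = ends e ≡ (a , b) ⊎ ends e ≡ (b , a)

  -- G has a closed trail containing every edge: the edges listed in an order
  -- σ(0),…,σ(m-1) without repetition and covering all edges (σ a bijection),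
  -- through vertices v₀,…,v_m with v_m = v₀, edge σ(i) joining v_i and v_{i+1}.
  Eulerian : Set
  Eulerian =
    Σ (Fin m ⤖ Fin m) λ σ →
    Σ (Fin (suc m) → Fin n) λ v →
      (v (fromℕ m) ≡ v zero) ×
      (∀ i → Joins (Bijection.to σ i) (v (inject₁ i)) (v (suc i)))

  Proper : (Fin m → ℕ) → Set
  Proper c = ∀ e f v → e ≢ f → Incident e v → Incident f v → c e ≢ c f

  IntervalColoring : ℕ → (Fin m → ℕ) → Set
  IntervalColoring t c =
    Proper c ×
    (∀ e → 1 ≤ c e × c e ≤ t) ×
    (∀ k → 1 ≤ k → k ≤ t → ∃ λ e → c e ≡ k) ×
    (∀ v e f k → Incident e v → Incident f v → c e ≤ k → k ≤ c f →
       ∃ λ g → Incident g v × c g ≡ k)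

  IntervalColorable : Set
  IntervalColorable = Σ ℕ λ t → 1 ≤ t × Σ (Fin m → ℕ) (IntervalColoring t)

module Submission where

-- At a vertex v the colours of
-- the incident edges are pairwise distinct and form an interval; since the
-- closed Euler trail enters and leaves v equally often, deg v is even.  An
-- interval of even length contains as many even as odd integers, so v meets as
-- many even-coloured as odd-coloured edges.  Summing over all vertices counts
-- every edge twice (handshake), hence the numbers of even- and odd-coloured
-- edges agree and m is twice the former.

open import Defs
open import Data.Nat using (ℕ; zero; suc; _+_; _*_; _≤_; _<_; z≤n; s≤s; _≟_)
open import Data.Nat.Properties
open import Data.Nat.Divisibility using (_∣_; divides; ∣-refl; ∣1⇒≡1; ∣m+n∣m⇒∣n; m∣m*n)
open import Data.Fin using (Fin; zero; suc; fromℕ; fromℕ<; inject₁; toℕ; punchIn)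
import Data.Fin as Fin
open import Data.Fin.Properties using (toℕ-injective; toℕ-fromℕ<; toℕ-fromℕ; toℕ-inject₁; toℕ<n; punchInᵢ≢i)
open import Data.Product using (_×_; _,_; proj₁; proj₂; ∃)
open import Data.Sum using (inj₁; inj₂)
open import Data.Empty using (⊥-elim)
open import Relation.Nullary using (¬_; Dec; yes; no)
open import Relation.Binary.PropositionalEquality
  using (_≡_; _≢_; refl; sym; trans; cong; cong₂; subst; module ≡-Reasoning)
open import Function.Bundles using (Bijection)
open import Function.Properties.Bijection using (⤖⇒↔)
open import Algebra.Properties.Semiring.Sum +-*-semiring
  using (sum; sum-cong-≗; sum-replicate-zero; sum-remove; sum-init-last;
         ∑-distrib-+; ∑-comm; ∑-permute; *-distribˡ-sum; *-distribʳ-sum)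

[_] : ∀ {p} {P : Set p} → Dec P → ℕ
[ yes _ ] = 1
[ no _ ] = 0

[]-yes : ∀ {p} {P : Set p} (d : Dec P) → P → [ d ] ≡ 1
[]-yes (yes _) _ = refl
[]-yes (no ¬p) p = ⊥-elim (¬p p)

[]-no : ∀ {p} {P : Set p} (d : Dec P) → ¬ P → [ d ] ≡ 0
[]-no (yes p) ¬p = ⊥-elim (¬p p)
[]-no (no _) _ = refl

[]≤1 : ∀ {p} {P : Set p} (d : Dec P) → [ d ] ≤ 1
[]≤1 (yes _) = s≤s z≤n
[]≤1 (no _) = z≤n

sum-zero : ∀ {n} (f : Fin n → ℕ) → (∀ i → f i ≡ 0) → sum f ≡ 0
sum-zero {n} f f≡0 = trans (sum-cong-≗ f≡0) (sum-replicate-zero n)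

sum-concentrated : ∀ {n} (f : Fin n → ℕ) (i : Fin n) →
                   (∀ j → j ≢ i → f j ≡ 0) → sum f ≡ f i
sum-concentrated {suc n} f i off = begin
  sum f                                  ≡⟨ sum-remove {i = i} f ⟩
  f i + sum (λ j → f (punchIn i j))      ≡⟨ cong (f i +_) (sum-zero _ (λ j → off _ (punchInᵢ≢i i j))) ⟩
  f i + 0                                ≡⟨ +-identityʳ (f i) ⟩
  f i                                    ∎
  where open ≡-Reasoning

term≤sum : ∀ {n} (f : Fin n → ℕ) (i : Fin n) → f i ≤ sum f
term≤sum {suc n} f i = ≤-trans (m≤m+n (f i) _) (≤-reflexive (sym (sum-remove {i = i} f)))

sum-positive : ∀ {n} (f : Fin n → ℕ) → 1 ≤ sum f → ∃ λ i → 1 ≤ f i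
sum-positive {suc n} f pos with f zero in eq
... | suc _ = zero , subst (1 ≤_) (sym eq) (s≤s z≤n)
... | zero with sum-positive (λ i → f (suc i)) pos
...   | i , fi>0 = suc i , fi>0

sum-≤1 : ∀ {n} (f : Fin n → ℕ) → (∀ i → f i ≤ 1) →
         (∀ i j → 1 ≤ f i → 1 ≤ f j → i ≡ j) → sum f ≤ 1
sum-≤1 f f≤1 unique with sum f in eq
... | zero = z≤n
... | suc k with sum-positive f (subst (1 ≤_) (sym eq) (s≤s z≤n))
...   | i , fi>0 = subst (_≤ 1) (trans (sym (sum-concentrated f i vanish)) eq) (f≤1 i)
  where
  vanish : ∀ j → j ≢ i → f j ≡ 0
  vanish j j≢i with f j in fj
  ... | zero = refl
  ... | suc _ = ⊥-elim (j≢i (unique j i (subst (1 ≤_) (sym fj) (s≤s z≤n)) fi>0))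

sum-point : ∀ {n} (i : Fin n) → sum (λ j → [ i Fin.≟ j ]) ≡ 1
sum-point i = trans (sum-concentrated _ i (λ j j≢i → []-no (i Fin.≟ j) (λ i≡j → j≢i (sym i≡j))))
                    ([]-yes (i Fin.≟ i) refl)

sum-ones : ∀ n → sum {n} (λ _ → 1) ≡ n
sum-ones zero = refl
sum-ones (suc n) = cong suc (sum-ones n)

sum-rotate : ∀ {n} (f : Fin (suc n) → ℕ) → f (fromℕ n) ≡ f zero →
             sum (λ i → f (suc i)) ≡ sum (λ i → f (inject₁ i))
sum-rotate {n} f closed = +-cancelˡ-≡ (f zero) _ _ (begin
  f zero + sum (λ i → f (suc i))       ≡⟨ sum-init-last {n} f ⟩
  sum (λ i → f (inject₁ i)) + f (fromℕ n) ≡⟨ cong (sum (λ i → f (inject₁ i)) +_) closed ⟩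
  sum (λ i → f (inject₁ i)) + f zero   ≡⟨ +-comm _ (f zero) ⟩
  f zero + sum (λ i → f (inject₁ i))   ∎)
  where open ≡-Reasoning

range : ℕ → (ℕ → ℕ) → ℕ
range T f = sum {T} (λ k → f (toℕ k))

range-suc : ∀ T (f : ℕ → ℕ) → range (suc T) f ≡ range T f + f T
range-suc T f = trans (sum-init-last {T} (λ k → f (toℕ k)))
  (cong₂ _+_ (sum-cong-≗ {T} (λ k → cong f (toℕ-inject₁ k))) (cong f (toℕ-fromℕ T)))

range-drop : ∀ T (f : ℕ → ℕ) → f T ≡ 0 → range (suc T) f ≡ range T f
range-drop T f fT≡0 = trans (range-suc T f) (trans (cong (range T f +_) fT≡0) (+-identityʳ _))

range-suc-suc : ∀ T (f : ℕ → ℕ) → range (suc (suc T)) f ≡ range T f + (f T + f (suc T))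
range-suc-suc T f = trans (range-suc (suc T) f)
  (trans (cong (_+ f (suc T)) (range-suc T f)) (+-assoc (range T f) (f T) (f (suc T))))

range-zero : ∀ T (f : ℕ → ℕ) → (∀ k → k < T → f k ≡ 0) → range T f ≡ 0
range-zero T f f≡0 = sum-zero _ (λ k → f≡0 (toℕ k) (toℕ<n k))

range-point : ∀ T (f : ℕ → ℕ) {a} → a < T → range T (λ k → [ a ≟ k ] * f k) ≡ f a
range-point T f {a} a<T =
  trans (sum-concentrated _ i off) (trans (cong (_* f (toℕ i)) ([]-yes (a ≟ toℕ i) (sym toℕi≡a)))
                                         (trans (+-identityʳ _) (cong f toℕi≡a)))
  where
  i : Fin T
  i = fromℕ< a<T
  toℕi≡a : toℕ i ≡ a
  toℕi≡a = toℕ-fromℕ< a<T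
  off : ∀ j → j ≢ i → [ a ≟ toℕ j ] * f (toℕ j) ≡ 0
  off j j≢i = cong (_* f (toℕ j)) ([]-no (a ≟ toℕ j) (λ a≡j → j≢i (toℕ-injective (trans (sym a≡j) (sym toℕi≡a)))))

sum-by-value : ∀ {m} T (a : Fin m → ℕ) (c : Fin m → ℕ) (w : ℕ → ℕ) → (∀ e → c e < T) →
  sum {m} (λ e → a e * w (c e)) ≡ range T (λ k → sum {m} (λ e → a e * [ c e ≟ k ]) * w k)
sum-by-value {m} T a c w c<T = begin
  sum {m} (λ e → a e * w (c e))
    ≡⟨ sum-cong-≗ {m} (λ e → cong (a e *_) (sym (range-point T w (c<T e)))) ⟩
  sum {m} (λ e → a e * range T (λ k → [ c e ≟ k ] * w k))
    ≡⟨ sum-cong-≗ {m} (λ e → *-distribˡ-sum {T} (a e) (λ k → [ c e ≟ toℕ k ] * w (toℕ k))) ⟩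
  sum {m} (λ e → range T (λ k → a e * ([ c e ≟ k ] * w k)))
    ≡⟨ ∑-comm {m} {T} (λ e k → a e * ([ c e ≟ toℕ k ] * w (toℕ k))) ⟩
  range T (λ k → sum {m} (λ e → a e * ([ c e ≟ k ] * w k)))
    ≡⟨ sum-cong-≗ {T} (λ k → trans (sum-cong-≗ {m} (λ e → sym (*-assoc (a e) _ _))) (sym (*-distribʳ-sum {m} (w (toℕ k)) (λ e → a e * [ c e ≟ toℕ k ])))) ⟩
  range T (λ k → sum {m} (λ e → a e * [ c e ≟ k ]) * w k) ∎
  where open ≡-Reasoning

_·_ : (ℕ → ℕ) → (ℕ → ℕ) → ℕ → ℕ
(f · w) k = f k * w k

evenw oddw : ℕ → ℕ
evenw zero = 1
evenw (suc k) = oddw k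
oddw zero = 0
oddw (suc k) = evenw k

evenw+oddw : ∀ k → evenw k + oddw k ≡ 1
evenw+oddw zero = refl
evenw+oddw (suc k) = trans (+-comm (oddw k) (evenw k)) (evenw+oddw k)

evenw-consecutive : ∀ k → evenw k + evenw (suc k) ≡ 1
evenw-consecutive = evenw+oddw

oddw-consecutive : ∀ k → oddw k + oddw (suc k) ≡ 1
oddw-consecutive k = trans (+-comm (oddw k) (evenw k)) (evenw+oddw k)

¬2∣1 : ¬ (2 ∣ 1)
¬2∣1 2∣1 with ∣1⇒≡1 2∣1
... | ()

2∣n+n : ∀ n → 2 ∣ n + n
2∣n+n n = divides n (trans (cong (n +_) (sym (+-identityʳ n))) (*-comm 2 n))

-- The topmost two ones of the
-- segment sit at consecutive positions of different parity; dropping them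
-- preserves the hypotheses, which gives an induction on T.
module IntervalParity
  (y : ℕ → ℕ) (y≤1 : ∀ k → y k ≤ 1)
  (convex : ∀ i j k → 1 ≤ y i → 1 ≤ y j → i ≤ k → k ≤ j → 1 ≤ y k) where

  gap-below : ∀ T → y T ≡ 0 → y (suc T) ≡ 1 → range T y ≡ 0
  gap-below T yT≡0 yT+1≡1 = range-zero T y vanish
    where
    vanish : ∀ k → k < T → y k ≡ 0
    vanish k k<T with n≤1⇒n≡0∨n≡1 (y≤1 k)
    ... | inj₁ yk≡0 = yk≡0
    ... | inj₂ yk≡1 = ⊥-elim (1+n≰n (subst (1 ≤_) yT≡0
            (convex k (suc T) T (≤-reflexive (sym yk≡1)) (≤-reflexive (sym yT+1≡1)) (<⇒≤ k<T) (n≤1+n T))))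

  lone-top-odd : ∀ T → y T ≡ 1 → range T y ≡ 0 → ¬ 2 ∣ range (suc T) y
  lone-top-odd T yT≡1 below 2∣ = ¬2∣1 (subst (2 ∣_) (trans (range-suc T y) (cong₂ _+_ below yT≡1)) 2∣)

  range-top-two : ∀ T (w : ℕ → ℕ) → y T ≡ 1 → y (suc T) ≡ 1 →
    range (suc (suc T)) (y · w) ≡ range T (y · w) + (w T + w (suc T))
  range-top-two T w yT≡1 yT+1≡1 =
    trans (range-suc-suc T (y · w)) (cong (range T (y · w) +_) (cong₂ _+_ (one T yT≡1) (one (suc T) yT+1≡1)))
    where
    one : ∀ k → y k ≡ 1 → y k * w k ≡ w k
    one k yk≡1 = trans (cong (_* w k) yk≡1) (+-identityʳ (w k))

  balanced     : ∀ T → 2 ∣ range T y → range T (y · evenw) ≡ range T (y · oddw)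
  balanced-top : ∀ T → y T ≡ 1 → 2 ∣ range (suc T) y →
                 range (suc T) (y · evenw) ≡ range (suc T) (y · oddw)

  balanced zero _ = refl
  balanced (suc T) 2∣ with n≤1⇒n≡0∨n≡1 (y≤1 T)
  ... | inj₂ yT≡1 = balanced-top T yT≡1 2∣
  ... | inj₁ yT≡0 = begin
    range (suc T) (y · evenw)  ≡⟨ range-drop T (y · evenw) (cong (_* evenw T) yT≡0) ⟩
    range T (y · evenw)        ≡⟨ balanced T (subst (2 ∣_) (range-drop T y yT≡0) 2∣) ⟩
    range T (y · oddw)         ≡⟨ range-drop T (y · oddw) (cong (_* oddw T) yT≡0) ⟨
    range (suc T) (y · oddw)   ∎
    where open ≡-Reasoning

  balanced-top zero y0≡1 2∣ = ⊥-elim (lone-top-odd zero y0≡1 refl 2∣)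
  balanced-top (suc T) yT+1≡1 2∣ with n≤1⇒n≡0∨n≡1 (y≤1 T)
  ... | inj₁ yT≡0 = ⊥-elim (lone-top-odd (suc T) yT+1≡1 below 2∣)
    where
    below : range (suc T) y ≡ 0
    below = trans (range-drop T y yT≡0) (gap-below T yT≡0 yT+1≡1)
  ... | inj₂ yT≡1 = begin
    range (suc (suc T)) (y · evenw)  ≡⟨ range-top-two T evenw yT≡1 yT+1≡1 ⟩
    range T (y · evenw) + (evenw T + evenw (suc T))
      ≡⟨ cong₂ _+_ (balanced T 2∣rest) (trans (evenw-consecutive T) (sym (oddw-consecutive T))) ⟩
    range T (y · oddw) + (oddw T + oddw (suc T))
      ≡⟨ range-top-two T oddw yT≡1 yT+1≡1 ⟨
    range (suc (suc T)) (y · oddw)   ∎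
    where
    open ≡-Reasoning
    2∣rest : 2 ∣ range T y
    2∣rest = ∣m+n∣m⇒∣n (subst (2 ∣_) (trans (range-suc-suc T y) (trans (cong₂ (λ a b → range T y + (a + b)) yT≡1 yT+1≡1) (+-comm (range T y) 2))) 2∣) ∣-refl

module _ (G : Multigraph) where
  open Multigraph G

  incidence : Fin m → Fin n → ℕ
  incidence e v = [ proj₁ (ends e) Fin.≟ v ] + [ proj₂ (ends e) Fin.≟ v ]

  degree : Fin n → ℕ
  degree v = sum (λ e → incidence e v)

  incidence≤1 : ∀ e v → incidence e v ≤ 1
  incidence≤1 e v with proj₁ (ends e) Fin.≟ v | proj₂ (ends e) Fin.≟ v
  ... | yes p | yes q = ⊥-elim (noLoop e (trans p (sym q)))
  ... | yes _ | no _  = ≤-refl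
  ... | no _  | yes _ = ≤-refl
  ... | no _  | no _  = z≤n

  incidence⇒Incident : ∀ e v → 1 ≤ incidence e v → Incident G e v
  incidence⇒Incident e v pos with proj₁ (ends e) Fin.≟ v | proj₂ (ends e) Fin.≟ v
  ... | yes p | _     = inj₁ p
  ... | no _  | yes q = inj₂ q
  ... | no _  | no _  with pos
  ...   | ()

  Incident⇒incidence : ∀ e v → Incident G e v → 1 ≤ incidence e v
  Incident⇒incidence e v (inj₁ p) =
    subst (_≤ incidence e v) ([]-yes (proj₁ (ends e) Fin.≟ v) p) (m≤m+n _ _)
  Incident⇒incidence e v (inj₂ q) =
    subst (_≤ incidence e v) ([]-yes (proj₂ (ends e) Fin.≟ v) q) (m≤n+m _ _)

  incidence-joins : ∀ e a b v → Joins G e a b → incidence e v ≡ [ a Fin.≟ v ] + [ b Fin.≟ v ]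
  incidence-joins e a b v (inj₁ ends≡ab) = cong (λ p → [ proj₁ p Fin.≟ v ] + [ proj₂ p Fin.≟ v ]) ends≡ab
  incidence-joins e a b v (inj₂ ends≡ba) =
    trans (cong (λ p → [ proj₁ p Fin.≟ v ] + [ proj₂ p Fin.≟ v ]) ends≡ba) (+-comm [ b Fin.≟ v ] _)

  -- Handshake lemma with edge weights: every edge has exactly two ends.
  handshake : (g : Fin m → ℕ) → sum (λ v → sum (λ e → incidence e v * g e)) ≡ 2 * sum g
  handshake g = begin
    sum (λ v → sum (λ e → incidence e v * g e))  ≡⟨ ∑-comm {n} {m} (λ v e → incidence e v * g e) ⟩
    sum (λ e → sum (λ v → incidence e v * g e))  ≡⟨ sum-cong-≗ {m} ends-of ⟩
    sum (λ e → 2 * g e)                          ≡⟨ *-distribˡ-sum {m} 2 g ⟨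
    2 * sum g                                    ∎
    where
    open ≡-Reasoning
    two-ends : ∀ e → sum (λ v → incidence e v) ≡ 2
    two-ends e = trans (∑-distrib-+ {n} (λ v → [ proj₁ (ends e) Fin.≟ v ]) (λ v → [ proj₂ (ends e) Fin.≟ v ]))
                       (cong₂ _+_ (sum-point (proj₁ (ends e))) (sum-point (proj₂ (ends e))))
    ends-of : ∀ e → sum (λ v → incidence e v * g e) ≡ 2 * g e
    ends-of e = trans (sym (*-distribʳ-sum {n} (g e) (λ v → incidence e v))) (cong (_* g e) (two-ends e))

  -- In an Eulerian multigraph every degree is even: along the closed trail
  -- each visit of v accounts for two ends at v (arriving and leaving).
  eulerian-even-degree : Eulerian G → ∀ v → 2 ∣ degree v
  eulerian-even-degree (σ , walk , closed , joins) v = subst (2 ∣_) (sym degree≡) (2∣n+n visits)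
    where
    open ≡-Reasoning
    visit : Fin (suc m) → ℕ
    visit j = [ walk j Fin.≟ v ]
    visits : ℕ
    visits = sum (λ i → visit (inject₁ i))
    degree≡ : degree v ≡ visits + visits
    degree≡ = begin
      degree v                                              ≡⟨ ∑-permute {m} {m} (λ e → incidence e v) (⤖⇒↔ σ) ⟩
      sum (λ i → incidence (Bijection.to σ i) v)            ≡⟨ sum-cong-≗ {m} (λ i → incidence-joins _ _ _ v (joins i)) ⟩
      sum (λ i → visit (inject₁ i) + visit (suc i))         ≡⟨ ∑-distrib-+ {m} (λ i → visit (inject₁ i)) (λ i → visit (suc i)) ⟩
      visits + sum (λ i → visit (suc i))                    ≡⟨ cong (visits +_) (sum-rotate visit (cong (λ u → [ u Fin.≟ v ]) closed)) ⟩
      visits + visits                                       ∎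

module ColourCounts (G : Multigraph) (c : Fin (Multigraph.m G) → ℕ) where
  open Multigraph G

  Gapless : Set
  Gapless = ∀ v e f k → Incident G e v → Incident G f v → c e ≤ k → k ≤ c f →
            ∃ λ g → Incident G g v × c g ≡ k

  colourCount : Fin n → ℕ → ℕ
  colourCount v k = sum (λ e → incidence G e v * [ c e ≟ k ])

  counted⇒ : ∀ v k e → 1 ≤ incidence G e v * [ c e ≟ k ] → Incident G e v × c e ≡ k
  counted⇒ v k e pos with c e ≟ k
  ... | yes ce≡k = incidence⇒Incident G e v (subst (1 ≤_) (*-identityʳ _) pos) , ce≡k
  ... | no _ with subst (1 ≤_) (*-zeroʳ (incidence G e v)) pos
  ...   | ()

  ⇒counted : ∀ v k e → Incident G e v → c e ≡ k → 1 ≤ incidence G e v * [ c e ≟ k ]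
  ⇒counted v k e inc ce≡k =
    subst (1 ≤_) (sym (trans (cong (incidence G e v *_) ([]-yes (c e ≟ k) ce≡k)) (*-identityʳ _)))
          (Incident⇒incidence G e v inc)

  colourCount≤1 : Proper G c → ∀ v k → colourCount v k ≤ 1
  colourCount≤1 proper v k = sum-≤1 _ (λ e → *-mono-≤ (incidence≤1 G e v) ([]≤1 (c e ≟ k))) unique
    where
    unique : ∀ e f → 1 ≤ incidence G e v * [ c e ≟ k ] → 1 ≤ incidence G f v * [ c f ≟ k ] → e ≡ f
    unique e f pe pf with e Fin.≟ f | counted⇒ v k e pe | counted⇒ v k f pf
    ... | yes e≡f | _ | _ = e≡f
    ... | no e≢f | inc-e , ce≡k | inc-f , cf≡k = ⊥-elim (proper e f v e≢f inc-e inc-f (trans ce≡k (sym cf≡k)))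

  colourCount-convex : Gapless → ∀ v i j k → 1 ≤ colourCount v i → 1 ≤ colourCount v j →
                       i ≤ k → k ≤ j → 1 ≤ colourCount v k
  colourCount-convex gapless v i j k pi pj i≤k k≤j
    with sum-positive _ pi | sum-positive _ pj
  ... | e , pe | f , pf with counted⇒ v i e pe | counted⇒ v j f pf
  ...   | inc-e , refl | inc-f , refl with gapless v e f k inc-e inc-f i≤k k≤j
  ...     | g , inc-g , cg≡k = ≤-trans (⇒counted v k g inc-g cg≡k) (term≤sum _ g)

  by-colour : ∀ T → (∀ e → c e < T) → ∀ v (w : ℕ → ℕ) →
    sum (λ e → incidence G e v * w (c e)) ≡ range T (colourCount v · w)
  by-colour T c<T v w = sum-by-value T (λ e → incidence G e v) c w c<T

  degree-by-colour : ∀ T → (∀ e → c e < T) → ∀ v → degree G v ≡ range T (colourCount v)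
  degree-by-colour T c<T v = begin
    degree G v                                   ≡⟨ sum-cong-≗ {m} (λ e → sym (*-identityʳ (incidence G e v))) ⟩
    sum (λ e → incidence G e v * 1)              ≡⟨ by-colour T c<T v (λ _ → 1) ⟩
    range T (colourCount v · (λ _ → 1))          ≡⟨ sum-cong-≗ {T} (λ k → *-identityʳ (colourCount v (toℕ k))) ⟩
    range T (colourCount v)                      ∎
    where open ≡-Reasoning

  local-balance : Proper G c → Gapless → ∀ T → (∀ e → c e < T) → ∀ v → 2 ∣ degree G v →
    sum (λ e → incidence G e v * evenw (c e)) ≡ sum (λ e → incidence G e v * oddw (c e))
  local-balance proper gapless T c<T v even = begin
    sum (λ e → incidence G e v * evenw (c e))  ≡⟨ by-colour T c<T v evenw ⟩
    range T (colourCount v · evenw)             ≡⟨ Parity.balanced T (subst (2 ∣_) (degree-by-colour T c<T v) even) ⟩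
    range T (colourCount v · oddw)              ≡⟨ by-colour T c<T v oddw ⟨
    sum (λ e → incidence G e v * oddw (c e))   ∎
    where
    open ≡-Reasoning
    module Parity = IntervalParity (colourCount v) (colourCount≤1 proper v) (colourCount-convex gapless v)

corollary1 : (G : Multigraph) → Eulerian G → IntervalColorable G →
    2 ∣ Multigraph.m G
corollary1 G eulerian (t , _ , c , proper , bounds , _ , gapless) =
  subst (2 ∣_) (sym m≡2*evens) (m∣m*n (count evenw))
  where
  open Multigraph G
  open ColourCounts G c
  open ≡-Reasoning

  count : (ℕ → ℕ) → ℕ
  count w = sum (λ e → w (c e))

  colour<suc-t : ∀ e → c e < suc t
  colour<suc-t e = s≤s (proj₂ (bounds e))

  evens≡odds : count evenw ≡ count oddw
  evens≡odds = *-cancelˡ-≡ (count evenw) (count oddw) 2 (begin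
    2 * count evenw                                            ≡⟨ handshake G (λ e → evenw (c e)) ⟨
    sum (λ v → sum (λ e → incidence G e v * evenw (c e)))      ≡⟨ sum-cong-≗ {n} (λ v →
         local-balance proper gapless (suc t) colour<suc-t v (eulerian-even-degree G eulerian v)) ⟩
    sum (λ v → sum (λ e → incidence G e v * oddw (c e)))       ≡⟨ handshake G (λ e → oddw (c e)) ⟩
    2 * count oddw                                             ∎)

  m≡2*evens : m ≡ 2 * count evenw
  m≡2*evens = begin
    m                                      ≡⟨ sum-ones m ⟨
    sum {m} (λ _ → 1)                      ≡⟨ sum-cong-≗ {m} (λ e → sym (evenw+oddw (c e))) ⟩
    sum (λ e → evenw (c e) + oddw (c e))   ≡⟨ ∑-distrib-+ {m} (λ e → evenw (c e)) (λ e → oddw (c e)) ⟩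
    count evenw + count oddw               ≡⟨ cong (count evenw +_) (sym evens≡odds) ⟩
    count evenw + count evenw              ≡⟨ cong (count evenw +_) (sym (+-identityʳ (count evenw))) ⟩
    2 * count evenw                        ∎
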